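{- Let $(X,A+\{\tau\},\rightarrow)$ be a non-deterministic labelled transition system and let $\rho:X\times(A+\{\tau\})\times X\to\{\mathrm{true},\mathrm{false}\}$ be the corresponding weight function over the boolean semiring $\mathfrak 2=(\{\mathrm{true},\mathrm{false}\},\lor,\mathrm{false},\land,\mathrm{true})$, given by $\rho(x,\alpha,y)=\mathrm{true}$ iff $x\xrightarrow{\alpha}y$. Then an equivalence relation $R\subseteq X\times X$ is a weak non-deterministic bisimulation on $(X,A+\{\tau\},\rightarrow)$ if and only if it is a weak $\mathfrak 2$-bisimulation on $(X,A+\{\tau\},\rho)$.
   Context: Weak non-deterministic bisimulation: an equivalence $R$ such that for all $(x,x')\in R$, every $\alpha\in A+\{\tau\}$ and every class $C\in X/R$: $\exists y\in C.\,x\xRightarrow{\alpha}y\iff\exists y'\in C.\,x'\xRightarrow{\alpha}y'$, where $\xRightarrow{\tau}$ is the reflexive-transitive closure of $\xrightarrow{\tau}$ and $\xRightarrow{a}=\xRightarrow{\tau}\xrightarrow{a}\xRightarrow{\tau}$ for $a\in A$. Weak $\mathfrak W$-bisimulation for a semiring $\mathfrak W=(W,+,0,\cdot,1)$ admitting countable sums and a $\mathfrak W$-LTS $(X,A+\{\tau\},\rho)$: a finite path $\pi=x_0\xrightarrow{a_1}\cdots\xrightarrow{a_n}x_n$ (all steps with nonzero weight) has weight $\rho(\pi)=\prod_{i=1}^n\rho(x_{i-1},a_i,x_i)$ (empty product $=1$) and trace $a_1\cdots a_n$. For a set of traces $T$, $x\in X$, $C\subseteq X$, let $\langle\!\langle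 x,T,C\rangle\!\rangle$ be the set of finite paths $\pi$ from $x$ with last state in $C$, trace in $T$, and such that no prefix $\pi'\preceq\pi$ with $\pi'\neq\pi$ and trace in $T$ ends in $C$ (prefixes including the empty path); put $\rho(x,T,C)=\sum_{\pi\in\langle\!\langle x,T,C\rangle\!\rangle}\rho(\pi)$. An equivalence $R$ is a weak $\mathfrak W$-bisimulation iff for all $(x,x')\in R$, all $a\in A$ and all classes $C$ of $R$: $\rho(x,\tau^*a\tau^*,C)=\rho(x',\tau^*a\tau^*,C)$ and $\rho(x,\tau^*,C)=\rho(x',\tau^*,C)$. -}

module Defs where

open import Data.Product using (Σ; ∃; ∃-syntax; _×_; _,_)
open import Data.List using (List; []; _∷_; _++_)
open import Data.List.Relation.Unary.All using (All)
open import Data.Empty using (⊥)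
open import Relation.Binary.PropositionalEquality using (_≡_)
open import Relation.Binary.Construct.Closure.ReflexiveTransitive using (Star)
open import Function.Bundles using (_⇔_)

data Act (A : Set) : Set where
  act : A → Act A
  τ   : Act A

-- Under the boolean semiring 2 the weight ρ(x,α,y) = true iff x →α y;
-- booleans are represented by propositions (true = inhabited).
module LTS {A X : Set} (step : X → Act A → X → Set) where

  -- equivalence classes of R are the sets  R z  (z : X)
  -- Weak non-deterministic bisimulation

  _⇒τ_ : X → X → Set
  _⇒τ_ = Star (λ x y → step x τ y)

  _⇒[_]_ : X → Act A → X → Set
  x ⇒[ τ ] y     = x ⇒τ y
  x ⇒[ act a ] y = ∃[ x₁ ] ∃[ x₂ ] (x ⇒τ x₁ × step x₁ (act a) x₂ × x₂ ⇒τ y)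

  WeakNDBisim : (X → X → Set) → Set
  WeakNDBisim R = ∀ x x' → R x x' → ∀ (α : Act A) (z : X) →
    (∃[ y ] (R z y × x ⇒[ α ] y)) ⇔ (∃[ y' ] (R z y' × x' ⇒[ α ] y'))

  -- finite paths from x, each step of nonzero weight (i.e. a transition)
  data Path : X → Set where
    nil  : ∀ {x} → Path x
    cons : ∀ {x α y} → step x α y → Path y → Path x

  last : ∀ {x} → Path x → X
  last {x} nil = x
  last (cons _ p) = last p

  trace : ∀ {x} → Path x → List (Act A)
  trace nil = []
  trace (cons {α = α} _ p) = α ∷ trace p

  data _≺_ : ∀ {x} → Path x → Path x → Set where
    nil≺  : ∀ {x α y} {t : step x α y} {p : Path y} → nil ≺ cons t p
    cons≺ : ∀ {x α y} {t : step x α y} {p q : Path y} →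
            p ≺ q → cons t p ≺ cons t q

  TauStar : List (Act A) → Set
  TauStar = All (_≡ τ)

  TauATauStar : A → List (Act A) → Set
  TauATauStar a w = ∃[ l ] ∃[ r ] (TauStar l × TauStar r × w ≡ l ++ (act a ∷ r))

  InPaths : (x : X) → (List (Act A) → Set) → (X → Set) → Path x → Set
  InPaths x T C π = T (trace π) × C (last π) ×
    (∀ (π' : Path x) → π' ≺ π → T (trace π') → C (last π') → ⊥)

  -- ρ(x,T,C) = true in the boolean semiring: the countable disjunction
  -- over π ∈ ⟨⟨x,T,C⟩⟩ of ρ(π) (= true for every such path) holds,
  -- i.e. ⟨⟨x,T,C⟩⟩ is nonempty.
  ρ-true : X → (List (Act A) → Set) → (X → Set) → Set
  ρ-true x T C = Σ (Path x) (InPaths x T C)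

  -- equality of boolean values = logical equivalence
  Weak2Bisim : (X → X → Set) → Set
  Weak2Bisim R = ∀ x x' → R x x' →
    (∀ (a : A) (z : X) → ρ-true x (TauATauStar a) (R z) ⇔ ρ-true x' (TauATauStar a) (R z)) ×
    (∀ (z : X) → ρ-true x TauStar (R z) ⇔ ρ-true x' TauStar (R z))

module Submission where

-- Over the boolean semiring, ρ(x,T,C) = true says that the
-- set ⟨⟨x,T,C⟩⟩ of C-minimal paths from x with trace in T is nonempty.
-- For T = τ*aτ* (resp. τ*) we show that this holds iff x ⇒a y
-- (resp. x ⇒τ y) for some y ∈ C:
--   * a path with trace in τ*aτ* (resp. τ*) is literally a weak
--     transition to its last state.
-- With this pointwise characterisation the two bisimulation conditions are
-- equivalent for every relation R:
-- each side of each biconditional is replaced by an equivalent one.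

open import Defs
open import Axiom.ExcludedMiddle using (ExcludedMiddle)
open import Level using (0ℓ)
open import Relation.Binary.Structures using (IsEquivalence)
open import Function.Bundles using (_⇔_; mk⇔)
open import Function.Construct.Composition using () renaming (equivalence to ⇔-trans)
open import Function.Construct.Symmetry using (⇔-sym)
open import Data.Product using (Σ; ∃-syntax; _×_; _,_; proj₁; proj₂)
open import Data.List using (List; []; _∷_; _++_)
open import Data.List.Properties using (∷-injective)
open import Data.List.Relation.Unary.All using ([]; _∷_)
open import Data.Empty using (⊥)
open import Relation.Nullary using (yes; no)
open import Relation.Binary.PropositionalEquality using (_≡_; refl; sym; trans; subst; cong)
open import Relation.Binary.Construct.Closure.ReflexiveTransitive using (ε; _◅_)

⇔-transport : {P P' Q Q' : Set} → P ⇔ P' → Q ⇔ Q' → P ⇔ Q → P' ⇔ Q'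
⇔-transport p q pq = ⇔-trans (⇔-sym p) (⇔-trans pq q)

module WeakTransitionsAsPaths {A X : Set} (step : X → Act A → X → Set) where
  open LTS step

  -- The trace set attached to a label: τ*aτ* for a visible action a and
  -- τ* for τ, so that ρ(x, Traces α, C) is the weight used for label α.
  Traces : Act A → List (Act A) → Set
  Traces (act a) = TauATauStar a
  Traces τ       = TauStar

  minimal-prefix : ExcludedMiddle 0ℓ → ∀ {x} (P : Path x → Set) (π : Path x) → P π →
                   Σ (Path x) λ π' → P π' × (∀ π'' → π'' ≺ π' → P π'' → ⊥)
  minimal-prefix em P nil Pπ = nil , Pπ , λ _ ()
  minimal-prefix em P (cons t π) Pπ with em {P nil}
  ... | yes Pnil = nil , Pnil , λ _ ()
  ... | no ¬Pnil with minimal-prefix em (λ π' → P (cons t π')) π Pπ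
  ...   | π' , Pπ' , minimal = cons t π' , Pπ' , below
    where
    below : ∀ π'' → π'' ≺ cons t π' → P π'' → ⊥
    below .nil        nil≺                   = ¬Pnil
    below .(cons t _) (cons≺ {p = π''} lt) = minimal π'' lt

  τ-path⇒weak : ∀ {x} (π : Path x) → TauStar (trace π) → x ⇒τ last π
  τ-path⇒weak nil        _            = ε
  τ-path⇒weak (cons t π) (refl ∷ τs) = t ◅ τ-path⇒weak π τs

  act-path⇒weak : ∀ {a x} (π : Path x) (l r : List (Act A)) → TauStar l → TauStar r →
                  trace π ≡ l ++ (act a ∷ r) → x ⇒[ act a ] last π
  act-path⇒weak (cons {x = x} {y = y} t π) [] r _ τr eq with ∷-injective eq
  ... | refl , rest = x , y , ε , t , τ-path⇒weak π (subst TauStar (sym rest) τr)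
  act-path⇒weak (cons t π) (_ ∷ l) r (refl ∷ τl) τr eq with ∷-injective eq
  ... | refl , rest with act-path⇒weak π l r τl τr rest
  ...   | x₁ , x₂ , pre , u , post = x₁ , x₂ , t ◅ pre , u , post

  path⇒weak : ∀ {x} α (π : Path x) → Traces α (trace π) → x ⇒[ α ] last π
  path⇒weak (act a) π (l , r , τl , τr , eq) = act-path⇒weak π l r τl τr eq
  path⇒weak τ       π τs                     = τ-path⇒weak π τs

  prepend : ∀ {x x₁} → x ⇒τ x₁ → Path x₁ → Path x
  prepend ε       π = π
  prepend (t ◅ s) π = cons t (prepend s π)

  prepend-last : ∀ {x x₁} (s : x ⇒τ x₁) (π : Path x₁) → last (prepend s π) ≡ last π
  prepend-last ε       π = refl
  prepend-last (t ◅ s) π = prepend-last s π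

  prepend-τ : ∀ {x x₁} (s : x ⇒τ x₁) (π : Path x₁) →
              TauStar (trace π) → TauStar (trace (prepend s π))
  prepend-τ ε       π τs = τs
  prepend-τ (t ◅ s) π τs = refl ∷ prepend-τ s π τs

  prepend-act : ∀ {a x x₁} (s : x ⇒τ x₁) (π : Path x₁) →
                TauATauStar a (trace π) → TauATauStar a (trace (prepend s π))
  prepend-act ε       π inT = inT
  prepend-act (t ◅ s) π inT with prepend-act s π inT
  ... | l , r , τl , τr , eq = τ ∷ l , r , refl ∷ τl , τr , cong (τ ∷_) eq

  weak⇒path : ∀ {x y} α → x ⇒[ α ] y → Σ (Path x) λ π → Traces α (trace π) × last π ≡ y
  weak⇒path τ s = prepend s nil , prepend-τ s nil [] , prepend-last s nil
  weak⇒path (act a) (x₁ , x₂ , pre , u , post) =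
    prepend pre (cons u (prepend post nil)) ,
    prepend-act pre _ ([] , _ , [] , prepend-τ post nil [] , refl) ,
    trans (prepend-last pre _) (prepend-last post nil)

  WeakReach : X → Act A → (X → Set) → Set
  WeakReach x α C = ∃[ y ] (C y × x ⇒[ α ] y)

  ρ-true⇔weakReach : ExcludedMiddle 0ℓ → ∀ x α (C : X → Set) →
                     ρ-true x (Traces α) C ⇔ WeakReach x α C
  ρ-true⇔weakReach em x α C = mk⇔ to from
    where
    Candidate : Path x → Set
    Candidate π = Traces α (trace π) × C (last π)

    to : ρ-true x (Traces α) C → WeakReach x α C
    to (π , inT , inC , _) = last π , inC , path⇒weak α π inT

    from : WeakReach x α C → ρ-true x (Traces α) C
    from (y , inC , w) with weak⇒path α w
    ... | π , inT , refl with minimal-prefix em Candidate π (inT , inC)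
    ...   | π' , (inT' , inC') , minimal =
      π' , inT' , inC' , λ π'' lt inT'' inC'' → minimal π'' lt (inT'' , inC'')

  weakND⇔weak2 : ExcludedMiddle 0ℓ → (R : X → X → Set) → WeakNDBisim R ⇔ Weak2Bisim R
  weakND⇔weak2 em R = mk⇔ toWeak2 fromWeak2
    where
    ρ-agree : ∀ {x x'} α z → WeakReach x α (R z) ⇔ WeakReach x' α (R z) →
              ρ-true x (Traces α) (R z) ⇔ ρ-true x' (Traces α) (R z)
    ρ-agree {x} {x'} α z = ⇔-transport (⇔-sym (ρ-true⇔weakReach em x α (R z)))
                                       (⇔-sym (ρ-true⇔weakReach em x' α (R z)))

    weak-agree : ∀ {x x'} α z → ρ-true x (Traces α) (R z) ⇔ ρ-true x' (Traces α) (R z) →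
                 WeakReach x α (R z) ⇔ WeakReach x' α (R z)
    weak-agree {x} {x'} α z = ⇔-transport (ρ-true⇔weakReach em x α (R z))
                                          (ρ-true⇔weakReach em x' α (R z))

    toWeak2 : WeakNDBisim R → Weak2Bisim R
    toWeak2 bisim x x' r = (λ a z → ρ-agree (act a) z (bisim x x' r (act a) z))
                         , (λ z → ρ-agree τ z (bisim x x' r τ z))

    fromWeak2 : Weak2Bisim R → WeakNDBisim R
    fromWeak2 bisim x x' r (act a) z = weak-agree (act a) z (proj₁ (bisim x x' r) a z)
    fromWeak2 bisim x x' r τ       z = weak-agree τ z (proj₂ (bisim x x' r) z)

proposition1 : ExcludedMiddle 0ℓ → {A X : Set} (step : X → Act A → X → Set)
    (R : X → X → Set) → IsEquivalence R →
    LTS.WeakNDBisim step R ⇔ LTS.Weak2Bisim step R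
proposition1 em step R _ = WeakTransitionsAsPaths.weakND⇔weak2 step em R
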